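{- Let $G$ be a connected (finite, simple) graph with $n$ vertices. Then $G$ is properly quasi-transitively colourable if and only if there exists an induced proper subgraph $H$ of $G$ such that: (i) $H$ is connected; (ii) $2 \leq |V(H)| \leq n-1$; and (iii) for every vertex $v \in V(G)\setminus V(H)$, if $v$ is adjacent to some vertex of $V(H)$, then $v$ is adjacent to every vertex of $V(H)$.
   Context: A quasi-transitive $2$-edge-colouring of a graph $G$ is a map $c: E(G)\to\{R,B\}$ such that for all pairs of edges $xy, yz \in E(G)$ with $c(xy)\neq c(yz)$, we have $xz\in E(G)$. Such a colouring is trivial if it is constant on $E(G)$. A graph is properly quasi-transitively colourable if it admits a nontrivial quasi-transitive $2$-edge-colouring. -}

module Defs where

open import Data.Nat using (ℕ; suc; _≤_; _∸_)
open import Data.Fin using (Fin)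
open import Data.Fin.Subset using (Subset; _∈_; _∉_; ∣_∣)
open import Data.Bool using (Bool; true; false)
open import Data.List using (List; []; _∷_)
open import Data.Product using (Σ; ∃; ∃-syntax; _×_; _,_)
open import Relation.Binary.PropositionalEquality using (_≡_; _≢_)
open import Relation.Nullary using (¬_)

record Graph (n : ℕ) : Set where
  field
    adj    : Fin n → Fin n → Bool
    symm   : ∀ x y → adj x y ≡ adj y x
    irrefl : ∀ x → adj x x ≡ false

open Graph public

Adj : ∀ {n} → Graph n → Fin n → Fin n → Set
Adj G x y = adj G x y ≡ true

data WalkIn {n} (G : Graph n) (S : Subset n) : Fin n → Fin n → Set where
  here : ∀ {x} → x ∈ S → WalkIn G S x x
  step : ∀ {x y z} → x ∈ S → Adj G x y → WalkIn G S y z → WalkIn G S x z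

full : ∀ {n} → Subset n
full {n} = Data.Fin.Subset.⊤

ConnectedIn : ∀ {n} → Graph n → Subset n → Set
ConnectedIn G S = ∀ x y → x ∈ S → y ∈ S → WalkIn G S x y

Connected : ∀ {n} → Graph n → Set
Connected G = ConnectedIn G full

data Colour : Set where
  R B : Colour

-- A 2-edge-colouring: a colour for each ordered adjacent pair, required to
-- be symmetric, so that it is a function on (unordered) edges.
-- (The value of c on non-adjacent pairs is irrelevant.)
record EdgeColouring {n} (G : Graph n) : Set where
  field
    col     : Fin n → Fin n → Colour
    col-sym : ∀ x y → Adj G x y → col x y ≡ col y x

open EdgeColouring public

QuasiTransitive : ∀ {n} {G : Graph n} → EdgeColouring G → Set
QuasiTransitive {G = G} c =
  ∀ x y z → Adj G x y → Adj G y z → col c x y ≢ col c y z → Adj G x z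

Nontrivial : ∀ {n} {G : Graph n} → EdgeColouring G → Set
Nontrivial {G = G} c =
  ∃[ x ] ∃[ y ] ∃[ u ] ∃[ v ] (Adj G x y × Adj G u v × col c x y ≢ col c u v)

ProperlyQTColourable : ∀ {n} → Graph n → Set
ProperlyQTColourable G =
  ∃[ c ] (QuasiTransitive {G = G} c × Nontrivial {G = G} c)

-- Conditions (i)–(iii) on the vertex set S of an induced subgraph H = G[S].
GoodSubgraph : ∀ {n} → Graph n → Subset n → Set
GoodSubgraph {n} G S =
  ConnectedIn G S
  × 2 ≤ ∣ S ∣ × ∣ S ∣ ≤ n ∸ 1
  × (∀ v → v ∉ S → (∃[ h ] (h ∈ S × Adj G v h)) → ∀ h → h ∈ S → Adj G v h)

-- Extend a quasi-transitive colouring to the complete graph by giving every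
-- non-edge a third colour: quasi-transitivity says exactly that no triangle
-- is rainbow, so by Gallai's theorem one colour class is disconnected, and any
-- vertex outside a connected piece of a colour class sees that piece in a
-- single colour.  A red or blue component that is not spanning is then the
-- required subgraph H; if both are spanning, the non-edge class is
-- disconnected, and two of its components together form H, because all pairs
-- between them are edges of one colour, which a red and a blue spanning
-- connected class cannot both cross.  Conversely, colouring the edges inside
-- H red and all others blue is quasi-transitive by (iii), and it uses both
-- colours since H has an edge and G is connected.
module Submission where

open import Defs
open import Data.Bool using (Bool; true; false)
open import Data.Empty using (⊥; ⊥-elim)
open import Data.Fin using (Fin; zero; suc; toℕ; fromℕ<)
open import Data.Fin.Properties using (any?; suc-injective; toℕ-injective; toℕ-fromℕ<; toℕ<n)
open import Data.Fin.Subset using (Subset; _∈_; _∉_; ∣_∣; ⁅_⁆; _∪_; ⊤; inside; outside)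
open import Data.Fin.Subset.Properties using (_∈?_; ∈⊤; x∈⁅x⁆; x∈⁅y⁆⇒x≡y; x∈p∪q⁻; x∈p∪q⁺; p⊂q⇒∣p∣<∣q∣; p⊆q⇒∣p∣≤∣q∣; ∣⊤∣≡n; ∣⁅x⁆∣≡1; ∣p∣≤n)
open import Data.Nat using (ℕ; zero; suc; _+_; _≤_; _<_; _∸_; _<?_; z≤n; s≤s; s≤s⁻¹)
open import Data.Nat.Properties using (≤-trans; ≤-refl; <⇒≤; <-irrefl; <-≤-trans; +-suc; +-monoʳ-≤; m≤m+n; m<n⇒m<1+n; m<1+n⇒m<n∨m≡n)
open import Data.Vec.Base using (_∷_; here; there)
open import Data.Product using (∃; ∃₂; ∃-syntax; _×_; _,_; proj₂)
import Data.Sum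
open Data.Sum using (_⊎_; inj₁; inj₂; [_,_]′)
open import Data.Unit using (tt) renaming (⊤ to Unit)
open import Function using (_∘_; id)
open import Function.Bundles using (_⇔_; mk⇔)
open import Relation.Binary.Definitions using (DecidableEquality)
open import Relation.Binary.PropositionalEquality using (_≡_; _≢_; refl; sym; trans; cong; subst; module ≡-Reasoning)
open import Relation.Nullary using (¬_; Dec; yes; no; ¬?; _×-dec_)
open import Relation.Nullary.Decidable using (decidable-stable)

data Path {A : Set} (E : A → A → Set) (P : A → Set) : A → A → Set where
  here : ∀ {x} → P x → Path E P x x
  step : ∀ {x y z} → P x → E x y → Path E P y z → Path E P x z

module _ {A : Set} {E : A → A → Set} {P : A → Set} where

  head∈ : ∀ {x y} → Path E P x y → P x
  head∈ (here px) = px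
  head∈ (step px _ _) = px

  last∈ : ∀ {x y} → Path E P x y → P y
  last∈ (here py) = py
  last∈ (step _ _ w) = last∈ w

  _++_ : ∀ {x y z} → Path E P x y → Path E P y z → Path E P x z
  here _ ++ w′ = w′
  step px e w ++ w′ = step px e (w ++ w′)

  reverse : (∀ {a b} → E a b → E b a) → ∀ {x y} → Path E P x y → Path E P y x
  reverse E-sym (here px) = here px
  reverse E-sym (step px e w) = reverse E-sym w ++ step (head∈ w) (E-sym e) (here px)

  transport : (Q : A → Set) → (∀ {y z} → Q y → P z → E y z → Q z) → ∀ {x y} → Path E P x y → Q x → Q y
  transport Q closed (here _) qx = qx
  transport Q closed (step _ e w) qx = transport Q closed w (closed qx (head∈ w) e)

  exit : {Q : A → Set} → (∀ a → Dec (Q a)) → ∀ {x y} → Path E P x y → Q x → ¬ Q y →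
         ∃₂ λ a b → Q a × ¬ Q b × E a b
  exit Q? (here _) qx ¬qy = ⊥-elim (¬qy qx)
  exit Q? (step {y = y} _ e w) qx ¬qy with Q? y
  ... | yes qy = exit Q? w qy ¬qy
  ... | no ¬qy′ = _ , _ , qx , ¬qy′ , e

weaken : ∀ {A : Set} {E : A → A → Set} {P P′ : A → Set} → (∀ {z} → P z → P′ z) →
         ∀ {x y} → Path E P x y → Path E P′ x y
weaken f (here px) = here (f px)
weaken f (step px e w) = step (f px) e (weaken f w)

outside-or-full : ∀ {n} (S : Subset n) → (∃ λ w → w ∉ S) ⊎ (∀ w → w ∈ S)
outside-or-full S with any? (λ w → ¬? (w ∈? S))
... | yes w∉S = inj₁ w∉S
... | no none = inj₂ λ w → decidable-stable (w ∈? S) (λ w∉S → none (w , w∉S))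

full⇒n≤∣p∣ : ∀ {n} (S : Subset n) → (∀ w → w ∈ S) → n ≤ ∣ S ∣
full⇒n≤∣p∣ {n} S full = subst (_≤ ∣ S ∣) (∣⊤∣≡n n) (p⊆q⇒∣p∣≤∣q∣ {p = ⊤} (λ {w} _ → full w))

x∉p⇒∣p∣≤n∸1 : ∀ {n} {S : Subset n} {w} → w ∉ S → ∣ S ∣ ≤ n ∸ 1
x∉p⇒∣p∣≤n∸1 {suc n} {S} {w} w∉S =
  s≤s⁻¹ (subst (∣ S ∣ <_) (∣⊤∣≡n (suc n)) (p⊂q⇒∣p∣<∣q∣ ((λ _ → ∈⊤) , w , ∈⊤ , w∉S)))

∣p∣≤n∸1⇒∃∉ : ∀ {n} {S : Subset n} → Fin n → ∣ S ∣ ≤ n ∸ 1 → ∃ λ w → w ∉ S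
∣p∣≤n∸1⇒∃∉ {suc n} {S} _ ∣S∣≤n with outside-or-full S
... | inj₁ w∉S = w∉S
... | inj₂ full = ⊥-elim (<-irrefl refl (≤-trans (full⇒n≤∣p∣ S full) ∣S∣≤n))

distinct∈⇒2≤∣p∣ : ∀ {n} {S : Subset n} {a b} → a ∈ S → b ∈ S → a ≢ b → 2 ≤ ∣ S ∣
distinct∈⇒2≤∣p∣ {S = S} {a} {b} a∈S b∈S a≢b = subst (λ m → suc m ≤ ∣ S ∣) (∣⁅x⁆∣≡1 a)
  (p⊂q⇒∣p∣<∣q∣ ((λ x∈⁅a⁆ → subst (_∈ S) (sym (x∈⁅y⁆⇒x≡y a x∈⁅a⁆)) a∈S) ,
                b , b∈S , λ b∈⁅a⁆ → a≢b (sym (x∈⁅y⁆⇒x≡y a b∈⁅a⁆))))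

1≤∣p∣⇒∃∈ : ∀ {n} (S : Subset n) → 1 ≤ ∣ S ∣ → ∃ λ a → a ∈ S
1≤∣p∣⇒∃∈ (inside ∷ S) _ = zero , here
1≤∣p∣⇒∃∈ (outside ∷ S) 1≤∣S∣ with 1≤∣p∣⇒∃∈ S 1≤∣S∣
... | a , a∈S = suc a , there a∈S

2≤∣p∣⇒distinct∈ : ∀ {n} (S : Subset n) → 2 ≤ ∣ S ∣ → ∃₂ λ a b → a ∈ S × b ∈ S × a ≢ b
2≤∣p∣⇒distinct∈ (inside ∷ S) (s≤s 1≤∣S∣) with 1≤∣p∣⇒∃∈ S 1≤∣S∣
... | a , a∈S = zero , suc a , here , there a∈S , λ ()
2≤∣p∣⇒distinct∈ (outside ∷ S) 2≤∣S∣ with 2≤∣p∣⇒distinct∈ S 2≤∣S∣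
... | a , b , a∈S , b∈S , a≢b = suc a , suc b , there a∈S , there b∈S , a≢b ∘ suc-injective

record Component {n} (E : Fin n → Fin n → Set) (T : Fin n → Set) (x : Fin n) : Set where
  field
    C         : Subset n
    ⊆T        : ∀ {y} → y ∈ C → T y
    ∋x        : x ∈ C
    closed    : ∀ {y z} → y ∈ C → T z → E y z → z ∈ C
    connected : ∀ {y z} → y ∈ C → z ∈ C → Path E (_∈ C) y z

open Component

module _ {n : ℕ} {E : Fin n → Fin n → Set} {T : Fin n → Set}
         (E? : ∀ x y → Dec (E x y)) (E-sym : ∀ {x y} → E x y → E y x) (T? : ∀ x → Dec (T x)) where

  private
    Linked : Subset n → Set
    Linked S = ∀ {y z} → y ∈ S → z ∈ S → Path E (_∈ S) y z

    ∈∪ˡ : ∀ {S : Subset n} {z y} → y ∈ S → y ∈ S ∪ ⁅ z ⁆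
    ∈∪ˡ y∈S = x∈p∪q⁺ (inj₁ y∈S)

    ∈∪ʳ : ∀ {S : Subset n} {z} → z ∈ S ∪ ⁅ z ⁆
    ∈∪ʳ {z = z} = x∈p∪q⁺ (inj₂ (x∈⁅x⁆ z))

    linked-∪ : ∀ {S y z} → y ∈ S → E y z → Linked S → Linked (S ∪ ⁅ z ⁆)
    linked-∪ {S} {y} {z} y∈S e linked {a} {b} a∈ b∈ with x∈p∪q⁻ S ⁅ z ⁆ a∈ | x∈p∪q⁻ S ⁅ z ⁆ b∈
    ... | inj₁ a∈S | inj₁ b∈S = weaken ∈∪ˡ (linked a∈S b∈S)
    ... | inj₁ a∈S | inj₂ b≡z rewrite x∈⁅y⁆⇒x≡y z b≡z =
      weaken ∈∪ˡ (linked a∈S y∈S) ++ step (∈∪ˡ y∈S) e (here ∈∪ʳ)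
    ... | inj₂ a≡z | inj₁ b∈S rewrite x∈⁅y⁆⇒x≡y z a≡z = step ∈∪ʳ (E-sym e) (weaken ∈∪ˡ (linked y∈S b∈S))
    ... | inj₂ a≡z | inj₂ b≡z rewrite x∈⁅y⁆⇒x≡y z a≡z | x∈⁅y⁆⇒x≡y z b≡z = here ∈∪ʳ

    frontier? : (S : Subset n) → Dec (∃₂ λ y z → y ∈ S × T z × z ∉ S × E y z)
    frontier? S = any? λ y → any? λ z → y ∈? S ×-dec T? z ×-dec ¬? (z ∈? S) ×-dec E? y z

    grow : ∀ {x} (fuel : ℕ) (S : Subset n) → n ≤ fuel + ∣ S ∣ → (∀ {y} → y ∈ S → T y) → x ∈ S → Linked S →
           Component E T x
    grow fuel S size S⊆T x∈S linked with frontier? S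
    ... | no none = record { C = S ; ⊆T = S⊆T ; ∋x = x∈S ; closed = closed′ ; connected = linked }
      where
        closed′ : ∀ {y z} → y ∈ S → T z → E y z → z ∈ S
        closed′ {y} {z} y∈S Tz e = decidable-stable (z ∈? S) (λ z∉S → none (y , z , y∈S , Tz , z∉S , e))
    ... | yes (y , z , y∈S , Tz , z∉S , e) with p⊂q⇒∣p∣<∣q∣ {p = S} {q = S ∪ ⁅ z ⁆} (∈∪ˡ , z , ∈∪ʳ , z∉S)
    ...   | ∣S∣<∣S∪z∣ with fuel
    ...     | zero = ⊥-elim (<-irrefl refl (<-≤-trans (<-≤-trans ∣S∣<∣S∪z∣ (∣p∣≤n (S ∪ ⁅ z ⁆))) size))
    ...     | suc fuel′ = grow fuel′ (S ∪ ⁅ z ⁆) size′ S∪z⊆T (∈∪ˡ x∈S) (linked-∪ y∈S e linked)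
      where
        size′ : n ≤ fuel′ + ∣ S ∪ ⁅ z ⁆ ∣
        size′ = ≤-trans size (subst (_≤ fuel′ + ∣ S ∪ ⁅ z ⁆ ∣) (+-suc fuel′ ∣ S ∣) (+-monoʳ-≤ fuel′ ∣S∣<∣S∪z∣))
        S∪z⊆T : ∀ {w} → w ∈ S ∪ ⁅ z ⁆ → T w
        S∪z⊆T w∈ with x∈p∪q⁻ S ⁅ z ⁆ w∈
        ... | inj₁ w∈S = S⊆T w∈S
        ... | inj₂ w≡z rewrite x∈⁅y⁆⇒x≡y z w≡z = Tz

  component : ∀ {x} → T x → Component E T x
  component {x} Tx = grow n ⁅ x ⁆ (m≤m+n n _) ⁅x⁆⊆T (x∈⁅x⁆ x) linked-⁅x⁆
    where
      ⁅x⁆⊆T : ∀ {y} → y ∈ ⁅ x ⁆ → T y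
      ⁅x⁆⊆T y∈ rewrite x∈⁅y⁆⇒x≡y x y∈ = Tx
      linked-⁅x⁆ : Linked ⁅ x ⁆
      linked-⁅x⁆ y∈ z∈ rewrite x∈⁅y⁆⇒x≡y x y∈ | x∈⁅y⁆⇒x≡y x z∈ = here (x∈⁅x⁆ x)

component-disjoint : ∀ {n} {E : Fin n → Fin n → Set} {T x y} (P : Component E T x) (Q : Component E T y) →
                     y ∉ C P → ∀ {q} → q ∈ C Q → q ∉ C P
component-disjoint P Q y∉P q∈Q q∈P =
  y∉P (transport (_∈ C P) (λ y∈P z∈Q e → closed P y∈P (⊆T Q z∈Q) e) (connected Q q∈Q (∋x Q)) q∈P)

module Gallai {K : Set} (_≟_ : DecidableEquality K)
              (others : ∀ i → ∃₂ λ (j l : K) → j ≢ i × l ≢ i × j ≢ l)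
              {n : ℕ} (κ : Fin n → Fin n → K) (κ-sym : ∀ x y → κ x y ≡ κ y x)
              (no-rainbow : ∀ x y z → κ x y ≢ κ y z → κ x z ≡ κ x y ⊎ κ x z ≡ κ y z) where

  open ≡-Reasoning

  Coloured : K → Fin n → Fin n → Set
  Coloured k x y = κ x y ≡ k

  Coloured-sym : ∀ {k x y} → Coloured k x y → Coloured k y x
  Coloured-sym {x = x} {y} = trans (κ-sym y x)

  colourComponent : ∀ k {T : Fin n → Set} → (∀ y → Dec (T y)) → ∀ {x} → T x → Component (Coloured k) T x
  colourComponent k = component (λ x y → κ x y ≟ k) Coloured-sym

  third-side : ∀ {x v y α β} → κ x v ≡ α → κ v y ≡ β → α ≢ β → κ x y ≢ β → κ x y ≡ α
  third-side {x} {v} {y} xv vy α≢β xy≢β with no-rainbow x v y (λ e → α≢β (trans (sym xv) (trans e vy)))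
  ... | inj₁ xy≡xv = trans xy≡xv xv
  ... | inj₂ xy≡vy = ⊥-elim (xy≢β (trans xy≡vy vy))

  uniform-along : ∀ {k} {P : Fin n → Set} {v} → (∀ {c} → P c → κ v c ≢ k) →
                  ∀ {c c′} → Path (Coloured k) P c c′ → κ v c ≡ κ v c′
  uniform-along v≁ (here _) = refl
  uniform-along v≁ (step pc e w) = trans (sym (third-side refl e (v≁ pc) (v≁ (head∈ w)))) (uniform-along v≁ w)

  module _ {i T x y} (P : Component (Coloured i) T x) (Q : Component (Coloured i) T y) (y∉P : y ∉ C P) where

    cross-≢ : ∀ {p q} → p ∈ C P → q ∈ C Q → κ p q ≢ i
    cross-≢ p∈P q∈Q pq≡i = component-disjoint P Q y∉P q∈Q (closed P p∈P (⊆T Q q∈Q) pq≡i)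

    cross-uniform : ∀ {p p′ q q′} → p ∈ C P → p′ ∈ C P → q ∈ C Q → q′ ∈ C Q → κ p q ≡ κ p′ q′
    cross-uniform {p} {p′} {q} {q′} p∈P p′∈P q∈Q q′∈Q = begin
      κ p q    ≡⟨ uniform-along (cross-≢ p∈P) (connected Q q∈Q q′∈Q) ⟩
      κ p q′   ≡⟨ κ-sym p q′ ⟩
      κ q′ p   ≡⟨ uniform-along (λ c∈P → cross-≢ c∈P q′∈Q ∘ trans (κ-sym _ _)) (connected P p∈P p′∈P) ⟩
      κ q′ p′  ≡⟨ κ-sym q′ p′ ⟩
      κ p′ q′  ∎

  -- The k-coloured graph on T is disconnected: D is closed under k-edges
  -- inside T and separates a from d.
  record Disconnected (k : K) (T : Fin n → Set) : Set where
    field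
      D        : Subset n
      a d      : Fin n
      a∈T      : T a
      d∈T      : T d
      a∈D      : a ∈ D
      d∉D      : d ∉ D
      D-closed : ∀ {y z} → y ∈ D → T z → κ y z ≡ k → z ∈ D

  module _ {i T x} (split : Disconnected i T) (P : Component (Coloured i) T x) where
    open Disconnected split

    component-⊉ : ∃ λ z → T z × z ∉ C P
    component-⊉ with a ∈? C P | d ∈? C P
    ... | no a∉P | _ = a , a∈T , a∉P
    ... | yes _ | no d∉P = d , d∈T , d∉P
    ... | yes a∈P | yes d∈P =
      ⊥-elim (d∉D (transport (_∈ D) (λ y∈D z∈P e → D-closed y∈D (⊆T P z∈P) e) (connected P a∈P d∈P) a∈D))

  -- Gallai's theorem is proved for the first m vertices, by induction on m.
  Below : ℕ → Fin n → Set
  Below m x = toℕ x < m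

  Below? : ∀ m x → Dec (Below m x)
  Below? m x = toℕ x <? m

  Below-suc : ∀ {m x} (m<n : m < n) → Below (suc m) x → Below m x ⊎ x ≡ fromℕ< m<n
  Below-suc m<n x<1+m with m<1+n⇒m<n∨m≡n x<1+m
  ... | inj₁ x<m = inj₁ x<m
  ... | inj₂ x≡m = inj₂ (toℕ-injective (trans x≡m (sym (toℕ-fromℕ< m<n))))

  module Step {m} (m<n : m < n) where

    v : Fin n
    v = fromℕ< m<n

    v∉Below : ¬ Below m v
    v∉Below = <-irrefl (toℕ-fromℕ< m<n)

    v∈Below : Below (suc m) v
    v∈Below = subst (_< suc m) (sym (toℕ-fromℕ< m<n)) ≤-refl

    isolated : ∀ {k a} → Below m a → (∀ {u} → Below m u → κ v u ≢ k) → Disconnected k (Below (suc m))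
    isolated {k} {a} a<m v≁ = record
      { D = ⁅ v ⁆ ; a = v ; d = a ; a∈T = v∈Below ; d∈T = m<n⇒m<1+n a<m ; a∈D = x∈⁅x⁆ v
      ; d∉D = λ a∈⁅v⁆ → v∉Below (subst (Below m) (x∈⁅y⁆⇒x≡y v a∈⁅v⁆) a<m) ; D-closed = closed′ }
      where
        closed′ : ∀ {y z} → y ∈ ⁅ v ⁆ → Below (suc m) z → κ y z ≡ k → z ∈ ⁅ v ⁆
        closed′ y∈⁅v⁆ z<1+m yz rewrite x∈⁅y⁆⇒x≡y v y∈⁅v⁆ with Below-suc m<n z<1+m
        ... | inj₁ z<m = ⊥-elim (v≁ z<m yz)
        ... | inj₂ refl = x∈⁅x⁆ v

    unreached : ∀ {i x d} (X : Component (Coloured i) (Below m) x) → (∀ {p} → p ∈ C X → κ v p ≢ i) →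
                Below m d → d ∉ C X → Disconnected i (Below (suc m))
    unreached {i} {x} {d} X v≁ d<m d∉X = record
      { D = C X ; a = x ; d = d ; a∈T = m<n⇒m<1+n (⊆T X (∋x X)) ; d∈T = m<n⇒m<1+n d<m
      ; a∈D = ∋x X ; d∉D = d∉X ; D-closed = closed′ }
      where
        closed′ : ∀ {y z} → y ∈ C X → Below (suc m) z → κ y z ≡ i → z ∈ C X
        closed′ y∈X z<1+m yz with Below-suc m<n z<1+m
        ... | inj₁ z<m = closed X y∈X z<m yz
        ... | inj₂ refl = ⊥-elim (v≁ y∈X (Coloured-sym yz))

    module _ {i j l} (j≢i : j ≢ i) (l≢i : l ≢ i) (j≢l : j ≢ l) {u w} (vu : κ v u ≡ j) (vw : κ v w ≡ l)
             (w<m : Below m w) (P : Component (Coloured i) (Below m) u) where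

      -- If both i-components P and Q receive an i-edge from v, then u (which
      -- v sees in colour j) and w (seen in colour l) would see the other
      -- component in the colours j and l, against cross-uniform.
      two-components : ∀ {z} (Q : Component (Coloured i) (Below m) z) → z ∉ C P → w ∈ C P ⊎ w ∈ C Q →
                       ∃ λ k → Disconnected k (Below (suc m))
      two-components Q z∉P w∈P⊎Q
        with any? (λ p → p ∈? C P ×-dec κ v p ≟ i) | any? (λ q → q ∈? C Q ×-dec κ v q ≟ i)
      ... | no none | _ = i , unreached P (λ p∈P vp → none (_ , p∈P , vp)) (⊆T Q (∋x Q)) z∉P
      ... | yes _ | no none =
        i , unreached Q (λ q∈Q vq → none (_ , q∈Q , vq)) (⊆T P (∋x P)) (λ u∈Q → component-disjoint P Q z∉P u∈Q (∋x P))
      ... | yes (p₁ , p₁∈P , vp₁) | yes (q₁ , q₁∈Q , vq₁) = ⊥-elim (j≢l (j≡l w∈P⊎Q))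
        where
          ≢i : ∀ {p q} → p ∈ C P → q ∈ C Q → κ p q ≢ i
          ≢i = cross-≢ P Q z∉P

          uq₁ : κ u q₁ ≡ j
          uq₁ = third-side (trans (κ-sym u v) vu) vq₁ j≢i (≢i (∋x P) q₁∈Q)

          wv : κ w v ≡ l
          wv = trans (κ-sym w v) vw

          j≡l : w ∈ C P ⊎ w ∈ C Q → j ≡ l
          j≡l (inj₁ w∈P) = begin
            j        ≡⟨ sym uq₁ ⟩
            κ u q₁   ≡⟨ cross-uniform P Q z∉P (∋x P) w∈P q₁∈Q q₁∈Q ⟩
            κ w q₁   ≡⟨ third-side wv vq₁ l≢i (≢i w∈P q₁∈Q) ⟩
            l        ∎
          j≡l (inj₂ w∈Q) = begin
            j        ≡⟨ sym uq₁ ⟩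
            κ u q₁   ≡⟨ cross-uniform P Q z∉P (∋x P) p₁∈P q₁∈Q w∈Q ⟩
            κ p₁ w   ≡⟨ κ-sym p₁ w ⟩
            κ w p₁   ≡⟨ third-side wv vp₁ l≢i (≢i p₁∈P w∈Q ∘ trans (κ-sym p₁ w)) ⟩
            l        ∎

      split-through-P : Disconnected i (Below m) → ∃ λ k → Disconnected k (Below (suc m))
      split-through-P split with component-⊉ split P | w ∈? C P
      ... | z , z<m , z∉P | yes w∈P = two-components (colourComponent i (Below? m) z<m) z∉P (inj₁ w∈P)
      ... | _ | no w∉P = two-components W w∉P (inj₂ (∋x W))
        where W = colourComponent i (Below? m) w<m

    -- If v misses colour j or l on the old vertices it is cut off in that
    -- colour; otherwise some old i-component receives no i-edge from v, so the
    -- i-class stays disconnected.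
    extend : ∀ {i} → Disconnected i (Below m) → ∃ λ k → Disconnected k (Below (suc m))
    extend {i} split with others i
    ... | j , l , j≢i , l≢i , j≢l
      with any? (λ u → Below? m u ×-dec κ v u ≟ j) | any? (λ w → Below? m w ×-dec κ v w ≟ l)
    ... | no none | _ = j , isolated (Disconnected.a∈T split) (λ u<m vu → none (_ , u<m , vu))
    ... | yes _ | no none = l , isolated (Disconnected.a∈T split) (λ w<m vw → none (_ , w<m , vw))
    ... | yes (u , u<m , vu) | yes (w , w<m , vw) =
      split-through-P j≢i l≢i j≢l vu vw w<m (colourComponent i (Below? m) u<m) split

  two-vertices : 1 < n → ∃ λ k → Disconnected k (Below 2)
  two-vertices 1<n with others (κ (Step.v 1<n) (Step.v (<⇒≤ 1<n)))
  ... | j , _ , j≢a₁a₀ , _ = j , Step.isolated 1<n (Step.v∈Below (<⇒≤ 1<n)) a₁≁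
    where
      a₁≁ : ∀ {u} → Below 1 u → κ (Step.v 1<n) u ≢ j
      a₁≁ u<1 a₁u with Below-suc (<⇒≤ 1<n) u<1
      ... | inj₂ refl = j≢a₁a₀ (sym a₁u)

  gallai-Below : ∀ m → 2 ≤ m → m ≤ n → ∃ λ k → Disconnected k (Below m)
  gallai-Below (suc zero) (s≤s ()) _
  gallai-Below (suc (suc zero)) _ 2≤n = two-vertices 2≤n
  gallai-Below (suc (suc (suc m))) _ m<n =
    Step.extend m<n (proj₂ (gallai-Below (suc (suc m)) (s≤s (s≤s z≤n)) (<⇒≤ m<n)))

  All : Fin n → Set
  All _ = Unit

  gallai : 2 ≤ n → ∃ λ k → Disconnected k All
  gallai 2≤n with gallai-Below n 2≤n ≤-refl
  ... | k , split = k , record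
    { D = D ; a = a ; d = d ; a∈T = tt ; d∈T = tt ; a∈D = a∈D ; d∉D = d∉D
    ; D-closed = λ y∈D _ yz → D-closed y∈D (toℕ<n _) yz }
    where open Disconnected split

  Spanning : K → Fin n → Set
  Spanning k b = ∀ w → Path (Coloured k) All b w

  spanning⇒¬disconnected : ∀ {k b} → Spanning k b → ¬ Disconnected k All
  spanning⇒¬disconnected span split = d∉D (transport (_∈ D) D-closed (span d) b∈D)
    where
      open Disconnected split
      b∈D = transport (_∈ D) D-closed (reverse Coloured-sym (span a)) a∈D

module GraphFacts {n} (G : Graph n) where

  adj-sym : ∀ {x y} → Adj G x y → Adj G y x
  adj-sym {x} {y} = trans (symm G y x)

  non-adjacent : ∀ {x y} → adj G x y ≡ false → ¬ Adj G x y
  non-adjacent xy≡false xy with trans (sym xy) xy≡false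
  ... | ()

  adj⇒≢ : ∀ {x y} → Adj G x y → x ≢ y
  adj⇒≢ {x} xy refl = non-adjacent (irrefl G x) xy

  first-edge : ∀ {S x y} → WalkIn G S x y → x ≢ y → ∃ λ z → Adj G x z × z ∈ S
  first-edge (here _) x≢y = ⊥-elim (x≢y refl)
  first-edge (step _ xz (here z∈S)) _ = _ , xz , z∈S
  first-edge (step _ xz (step z∈S _ _)) _ = _ , xz , z∈S

  goodSubgraph : ∀ {S a b w} → ConnectedIn G S → a ∈ S → b ∈ S → a ≢ b → w ∉ S →
                 (∀ v → v ∉ S → (∃[ h ] (h ∈ S × Adj G v h)) → ∀ h → h ∈ S → Adj G v h) → GoodSubgraph G S
  goodSubgraph connected a∈S b∈S a≢b w∉S attached =
    connected , distinct∈⇒2≤∣p∣ a∈S b∈S a≢b , x∉p⇒∣p∣≤n∸1 w∉S , attached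

≢⇒2≤n : ∀ {n} {x y : Fin n} → x ≢ y → 2 ≤ n
≢⇒2≤n {n} x≢y = subst (2 ≤_) (∣⊤∣≡n n) (distinct∈⇒2≤∣p∣ ∈⊤ ∈⊤ x≢y)

data Colour⁺ : Set where
  edge    : Colour → Colour⁺
  nonEdge : Colour⁺

colour⁺ : Bool → Colour → Colour⁺
colour⁺ true c = edge c
colour⁺ false _ = nonEdge

edge≢nonEdge : ∀ {c} → edge c ≢ nonEdge
edge≢nonEdge ()

_≟ᶜ_ : DecidableEquality Colour
R ≟ᶜ R = yes refl
R ≟ᶜ B = no λ ()
B ≟ᶜ R = no λ ()
B ≟ᶜ B = yes refl

_≟⁺_ : DecidableEquality Colour⁺
edge c ≟⁺ edge c′ with c ≟ᶜ c′
... | yes refl = yes refl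
... | no c≢c′ = no λ { refl → c≢c′ refl }
edge _ ≟⁺ nonEdge = no λ ()
nonEdge ≟⁺ edge _ = no λ ()
nonEdge ≟⁺ nonEdge = yes refl

others⁺ : ∀ i → ∃₂ λ (j l : Colour⁺) → j ≢ i × l ≢ i × j ≢ l
others⁺ (edge R) = edge B , nonEdge , (λ ()) , (λ ()) , (λ ())
others⁺ (edge B) = edge R , nonEdge , (λ ()) , (λ ()) , (λ ())
others⁺ nonEdge = edge R , edge B , (λ ()) , (λ ()) , (λ ())

other-colour : ∀ {a b c : Colour} → a ≢ b → c ≡ a ⊎ c ≡ b
other-colour {R} {R} {_} a≢b = ⊥-elim (a≢b refl)
other-colour {B} {B} {_} a≢b = ⊥-elim (a≢b refl)
other-colour {R} {B} {R} _ = inj₁ refl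
other-colour {R} {B} {B} _ = inj₂ refl
other-colour {B} {R} {R} _ = inj₂ refl
other-colour {B} {R} {B} _ = inj₁ refl

module Forward {n} (G : Graph n) (c : EdgeColouring G) (qt : QuasiTransitive {G = G} c) where

  open GraphFacts G

  κ : Fin n → Fin n → Colour⁺
  κ x y = colour⁺ (adj G x y) (col c x y)

  κ-sym : ∀ x y → κ x y ≡ κ y x
  κ-sym x y with adj G x y in xy
  ... | true rewrite adj-sym xy = cong edge (col-sym c x y xy)
  ... | false rewrite trans (symm G y x) xy = refl

  κ-no-rainbow : ∀ x y z → κ x y ≢ κ y z → κ x z ≡ κ x y ⊎ κ x z ≡ κ y z
  κ-no-rainbow x y z xy≢yz with adj G x y in xy | adj G y z in yz | adj G x z in xz
  ... | false | false | _     = ⊥-elim (xy≢yz refl)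
  ... | false | true  | false = inj₁ refl
  ... | true  | false | false = inj₂ refl
  ... | true  | true  | false = ⊥-elim (non-adjacent xz (qt x y z xy yz (xy≢yz ∘ cong edge)))
  ... | true  | true  | true  = Data.Sum.map (cong edge) (cong edge) (other-colour (xy≢yz ∘ cong edge))
  ... | true  | false | true with col c x z ≟ᶜ col c x y
  ...   | yes xz≡xy = inj₁ (cong edge xz≡xy)
  ...   | no xz≢xy =
    ⊥-elim (non-adjacent yz (adj-sym (qt z x y (adj-sym xz) xy (xz≢xy ∘ trans (col-sym c x z xz)))))
  κ-no-rainbow x y z xy≢yz | false | true | true with col c x z ≟ᶜ col c y z
  ...   | yes xz≡yz = inj₂ (cong edge xz≡yz)
  ...   | no xz≢yz = ⊥-elim (non-adjacent xy (qt x z y xz (adj-sym yz) (xz≢yz ∘ (λ e → trans e (sym (col-sym c y z yz))))))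

  open Gallai _≟⁺_ others⁺ κ κ-sym κ-no-rainbow

  ≢nonEdge⇒adj : ∀ {x y} → κ x y ≢ nonEdge → Adj G x y
  ≢nonEdge⇒adj {x} {y} xy≢nonEdge with adj G x y
  ... | true = refl
  ... | false = ⊥-elim (xy≢nonEdge refl)

  edge⇒adj : ∀ {k x y} → κ x y ≡ edge k → Adj G x y
  edge⇒adj xy = ≢nonEdge⇒adj (edge≢nonEdge ∘ trans (sym xy))

  adj⇒≢nonEdge : ∀ {x y} → Adj G x y → κ x y ≢ nonEdge
  adj⇒≢nonEdge xy rewrite xy = λ ()

  adj⇒edge : ∀ {x y} → Adj G x y → κ x y ≡ edge (col c x y)
  adj⇒edge xy rewrite xy = refl

  path⇒walk : ∀ {k S x y} → Path (Coloured (edge k)) (_∈ S) x y → WalkIn G S x y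
  path⇒walk (here x∈S) = here x∈S
  path⇒walk (step x∈S xy w) = step x∈S (edge⇒adj xy) (path⇒walk w)

  classComponent : ∀ k x → Component (Coloured k) All x
  classComponent k x = colourComponent k (λ _ → yes tt) tt

  Good : Set
  Good = ∃[ S ] GoodSubgraph G S

  component-spanning-or-good : ∀ {k p q} (X : Component (Coloured (edge k)) All p) → κ p q ≡ edge k →
                               Spanning (edge k) p ⊎ Good
  component-spanning-or-good {k} {p} {q} X pq with outside-or-full (C X)
  ... | inj₂ full = inj₁ λ w → weaken _ (connected X (∋x X) (full w))
  ... | inj₁ (w , w∉X) =
    inj₂ (C X , goodSubgraph (λ _ _ y∈X z∈X → path⇒walk (connected X y∈X z∈X))
                             (∋x X) (closed X (∋x X) tt pq) (adj⇒≢ (edge⇒adj pq)) w∉X attached)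
    where
      attached : ∀ v → v ∉ C X → (∃[ h ] (h ∈ C X × Adj G v h)) → ∀ h → h ∈ C X → Adj G v h
      attached v v∉X (h , h∈X , vh) h′ h′∈X = ≢nonEdge⇒adj λ vh′ → adj⇒≢nonEdge vh (begin
        κ v h   ≡⟨ uniform-along (λ c∈X vc → v∉X (closed X c∈X tt (Coloured-sym vc))) (connected X h∈X h′∈X) ⟩
        κ v h′  ≡⟨ vh′ ⟩
        nonEdge ∎)
        where open ≡-Reasoning

  spanning-or-good : ∀ {k p q} → κ p q ≡ edge k → Spanning (edge k) p ⊎ Good
  spanning-or-good {k} {p} = component-spanning-or-good (classComponent (edge k) p)

  module _ {a₁ a₂ b₁} (red : κ a₁ a₂ ≡ edge R) (spanR : Spanning (edge R) a₁) (spanB : Spanning (edge B) b₁) where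

    C₁ : Component (Coloured nonEdge) All a₁
    C₁ = classComponent nonEdge a₁

    module _ {y} (y∉C₁ : y ∉ C C₁) where

      C₂ : Component (Coloured nonEdge) All y
      C₂ = classComponent nonEdge y

      C₁∪C₂ : Subset n
      C₁∪C₂ = C C₁ ∪ C C₂

      cross-adj : ∀ {s t} → s ∈ C C₁ → t ∈ C C₂ → Adj G s t
      cross-adj s∈C₁ t∈C₂ = ≢nonEdge⇒adj (cross-≢ C₁ C₂ y∉C₁ s∈C₁ t∈C₂)

      ∪-connected : ConnectedIn G C₁∪C₂
      ∪-connected s t s∈ t∈ with x∈p∪q⁻ (C C₁) (C C₂) s∈ | x∈p∪q⁻ (C C₁) (C C₂) t∈
      ... | inj₁ s∈C₁ | inj₁ t∈C₁ = step s∈ (cross-adj s∈C₁ (∋x C₂)) (step y∈ (adj-sym (cross-adj t∈C₁ (∋x C₂))) (here t∈))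
        where y∈ = x∈p∪q⁺ (inj₂ (∋x C₂))
      ... | inj₁ s∈C₁ | inj₂ t∈C₂ = step s∈ (cross-adj s∈C₁ t∈C₂) (here t∈)
      ... | inj₂ s∈C₂ | inj₁ t∈C₁ = step s∈ (adj-sym (cross-adj t∈C₁ s∈C₂)) (here t∈)
      ... | inj₂ s∈C₂ | inj₂ t∈C₂ = step s∈ (adj-sym (cross-adj (∋x C₁) s∈C₂)) (step a₁∈ (cross-adj (∋x C₁) t∈C₂) (here t∈))
        where a₁∈ = x∈p∪q⁺ (inj₁ (∋x C₁))

      ∪-good : ∀ {w} → w ∉ C₁∪C₂ → GoodSubgraph G C₁∪C₂
      ∪-good w∉ = goodSubgraph ∪-connected (x∈p∪q⁺ (inj₁ (∋x C₁))) (x∈p∪q⁺ (inj₂ (∋x C₂)))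
                               (λ a₁≡y → y∉C₁ (subst (_∈ C C₁) a₁≡y (∋x C₁))) w∉ attached
        where
          attached : ∀ v → v ∉ C₁∪C₂ → (∃[ h ] (h ∈ C₁∪C₂ × Adj G v h)) → ∀ h → h ∈ C₁∪C₂ → Adj G v h
          attached v v∉ _ h h∈ with x∈p∪q⁻ (C C₁) (C C₂) h∈
          ... | inj₁ h∈C₁ = ≢nonEdge⇒adj λ vh → v∉ (x∈p∪q⁺ (inj₁ (closed C₁ h∈C₁ tt (Coloured-sym vh))))
          ... | inj₂ h∈C₂ = ≢nonEdge⇒adj λ vh → v∉ (x∈p∪q⁺ (inj₂ (closed C₂ h∈C₂ tt (Coloured-sym vh))))

      -- All pairs between C₁ and C₂ have one colour, yet the red and the blue
      -- class both connect a₁ ∈ C₁ to y ∈ C₂.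
      ∪-⊉ : ∃ λ w → w ∉ C₁∪C₂
      ∪-⊉ with outside-or-full C₁∪C₂
      ... | inj₁ w∉ = w∉
      ... | inj₂ full with exit (_∈? C C₁) (spanR y) (∋x C₁) y∉C₁
                         | exit (_∈? C C₁) (reverse Coloured-sym (spanB a₁) ++ spanB y) (∋x C₁) y∉C₁
      ...   | s , t , s∈C₁ , t∉C₁ , st | s′ , t′ , s′∈C₁ , t′∉C₁ , s′t′ =
        ⊥-elim (edge≢blue (trans (sym st) (trans (cross-uniform C₁ C₂ y∉C₁ s∈C₁ s′∈C₁ (in-C₂ t∉C₁) (in-C₂ t′∉C₁)) s′t′)))
        where
          edge≢blue : edge R ≢ edge B
          edge≢blue ()
          in-C₂ : ∀ {w} → w ∉ C C₁ → w ∈ C C₂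
          in-C₂ {w} w∉C₁ = [ ⊥-elim ∘ w∉C₁ , id ]′ (x∈p∪q⁻ (C C₁) (C C₂) (full w))

    both-spanning⇒good : Good
    both-spanning⇒good with outside-or-full (C C₁)
    ... | inj₁ (y , y∉C₁) = C₁∪C₂ y∉C₁ , ∪-good y∉C₁ (proj₂ (∪-⊉ y∉C₁))
    ... | inj₂ full with gallai (≢⇒2≤n (adj⇒≢ (edge⇒adj red)))
    ...   | edge R , split = ⊥-elim (spanning⇒¬disconnected spanR split)
    ...   | edge B , split = ⊥-elim (spanning⇒¬disconnected spanB split)
    ...   | nonEdge , split = ⊥-elim (spanning⇒¬disconnected (λ w → weaken _ (connected C₁ (∋x C₁) (full w))) split)

  red-and-blue : Nontrivial {G = G} c → (∃₂ λ a₁ a₂ → κ a₁ a₂ ≡ edge R) × (∃₂ λ b₁ b₂ → κ b₁ b₂ ≡ edge B)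
  red-and-blue (x , y , u , v , xy , uv , xy≢uv) with col c x y in cxy | col c u v in cuv
  ... | R | R = ⊥-elim (xy≢uv refl)
  ... | B | B = ⊥-elim (xy≢uv refl)
  ... | R | B = (x , y , trans (adj⇒edge xy) (cong edge cxy)) , (u , v , trans (adj⇒edge uv) (cong edge cuv))
  ... | B | R = (u , v , trans (adj⇒edge uv) (cong edge cuv)) , (x , y , trans (adj⇒edge xy) (cong edge cxy))

  goodSubgraph-exists : Nontrivial {G = G} c → Good
  goodSubgraph-exists nontrivial with red-and-blue nontrivial
  ... | (_ , _ , red) , (_ , _ , blue) with spanning-or-good red | spanning-or-good blue
  ...   | inj₂ good | _ = good
  ...   | inj₁ _ | inj₂ good = good
  ...   | inj₁ spanR | inj₁ spanB = both-spanning⇒good red spanR spanB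

module Backward {n} (G : Graph n) {S : Subset n} (connectedS : ConnectedIn G S) (2≤∣S∣ : 2 ≤ ∣ S ∣)
                (∣S∣≤n∸1 : ∣ S ∣ ≤ n ∸ 1)
                (attached : ∀ v → v ∉ S → (∃[ h ] (h ∈ S × Adj G v h)) → ∀ h → h ∈ S → Adj G v h) where

  open GraphFacts G

  both-inside : ∀ {A B : Set} → Dec A → Dec B → Colour
  both-inside (yes _) (yes _) = R
  both-inside (yes _) (no _) = B
  both-inside (no _) _ = B

  both-inside-comm : ∀ {A B : Set} (a? : Dec A) (b? : Dec B) → both-inside a? b? ≡ both-inside b? a?
  both-inside-comm (yes _) (yes _) = refl
  both-inside-comm (yes _) (no _) = refl
  both-inside-comm (no _) (yes _) = refl
  both-inside-comm (no _) (no _) = refl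

  colouring : EdgeColouring G
  colouring = record
    { col = λ x y → both-inside (x ∈? S) (y ∈? S)
    ; col-sym = λ x y _ → both-inside-comm (x ∈? S) (y ∈? S) }

  quasiTransitive : QuasiTransitive {G = G} colouring
  quasiTransitive x y z xy yz xy≢yz with x ∈? S | y ∈? S | z ∈? S
  ... | yes x∈S | yes y∈S | no z∉S = adj-sym (attached z z∉S (y , y∈S , adj-sym yz) x x∈S)
  ... | no x∉S | yes y∈S | yes z∈S = attached x x∉S (y , y∈S , xy) z z∈S
  ... | yes _ | yes _ | yes _ = ⊥-elim (xy≢yz refl)
  ... | no _ | yes _ | no _ = ⊥-elim (xy≢yz refl)
  ... | yes _ | no _ | _ = ⊥-elim (xy≢yz refl)
  ... | no _ | no _ | _ = ⊥-elim (xy≢yz refl)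

  col-inside : ∀ {x y} → x ∈ S → y ∈ S → col colouring x y ≡ R
  col-inside {x} {y} x∈S y∈S with x ∈? S | y ∈? S
  ... | yes _ | yes _ = refl
  ... | no x∉S | _ = ⊥-elim (x∉S x∈S)
  ... | yes _ | no y∉S = ⊥-elim (y∉S y∈S)

  col-outside : ∀ {x y} → x ∉ S → col colouring x y ≡ B
  col-outside {x} x∉S with x ∈? S
  ... | yes x∈S = ⊥-elim (x∉S x∈S)
  ... | no _ = refl

  nontrivial : Connected G → Nontrivial {G = G} colouring
  nontrivial connectedG with 2≤∣p∣⇒distinct∈ S 2≤∣S∣
  ... | a , b , a∈S , b∈S , a≢b with first-edge (connectedS a b a∈S b∈S) a≢b | ∣p∣≤n∸1⇒∃∉ a ∣S∣≤n∸1
  ...   | a′ , aa′ , a′∈S | v , v∉S with first-edge (connectedG v a ∈⊤ ∈⊤) (λ v≡a → v∉S (subst (_∈ S) (sym v≡a) a∈S))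
  ...     | v′ , vv′ , _ = a , a′ , v , v′ , aa′ , vv′ , λ R≡B → R≢B (trans (sym (col-inside a∈S a′∈S)) (trans R≡B (col-outside v∉S)))
    where
      R≢B : R ≢ B
      R≢B ()

theorem14 : (n : ℕ) (G : Graph n) → Connected G →
    ProperlyQTColourable G ⇔ (∃[ S ] GoodSubgraph G S)
theorem14 n G connectedG = mk⇔ forward backward
  where
    forward : ProperlyQTColourable G → ∃[ S ] GoodSubgraph G S
    forward (c , qt , nontrivial) = Forward.goodSubgraph-exists G c qt nontrivial

    backward : ∃[ S ] GoodSubgraph G S → ProperlyQTColourable G
    backward (S , connectedS , 2≤∣S∣ , ∣S∣≤n∸1 , attached) = colouring , quasiTransitive , nontrivial connectedG
      where open Backward G connectedS 2≤∣S∣ ∣S∣≤n∸1 attached
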